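{- Let $M_6$ be the simple graph on $6$ vertices whose complement is the disjoint union of two paths on $3$ vertices each. Let $P=\{p,t,t+s,t+2s,t+3s,t+4s\}$ where $p<0$, $t\ge 0$ and $s>0$ are integers (so $P$ consists of one negative number and an arithmetic progression of five non-negative numbers). Then $P$ is not a signature for $M_6$.
   Context: A finite simple graph $G=(V,E)$ has signature $S$ (a finite multiset of integers) if there is a bijection $\pi$ from the elements of $S$ to $V$ such that for any two distinct elements $s,t$ of $S$, $\pi(s)$ and $\pi(t)$ are adjacent iff $|s-t|\in S$. -}

module Defs where

open import Data.Nat using (ℕ)
open import Data.Integer using (ℤ; +_; _+_; _-_; _*_; ∣_∣)
open import Data.Fin using (Fin; zero; suc; toℕ)
open import Data.Product using (_×_; _,_; Σ; ∃)
open import Data.Sum using (_⊎_)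
open import Data.List using (List; _∷_; [])
open import Data.List.Membership.Propositional using (_∈_)
open import Relation.Binary.PropositionalEquality using (_≡_; _≢_)
open import Relation.Nullary using (¬_)
open import Function.Bundles using (_⤖_; _⇔_; Bijection)

-- A (multi)set S of n integers is given as a family S : Fin n → ℤ
-- (its elements, listed with multiplicity).
HasSignature : {n : ℕ} → (Fin n → Fin n → Set) → (Fin n → ℤ) → Set
HasSignature {n} Adj S =
  Σ (Fin n ⤖ Fin n) λ π →
    (i j : Fin n) → i ≢ j →
      Adj (Bijection.to π i) (Bijection.to π j)
        ⇔ (∃ λ k → S k ≡ + ∣ S i - S j ∣)

complementEdges : List (ℕ × ℕ)
complementEdges = (0 , 1) ∷ (1 , 2) ∷ (3 , 4) ∷ (4 , 5) ∷ []

ComplementAdj : Fin 6 → Fin 6 → Set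
ComplementAdj i j = ((toℕ i , toℕ j) ∈ complementEdges) ⊎ ((toℕ j , toℕ i) ∈ complementEdges)

M6Adj : Fin 6 → Fin 6 → Set
M6Adj i j = (i ≢ j) × ¬ ComplementAdj i j

Pset : ℤ → ℤ → ℤ → Fin 6 → ℤ
Pset p t s zero = p
Pset p t s (suc i) = t + (+ toℕ i) * s

module Submission where

-- Write P = {x₀, x₁, …, x₅} with x₀ = p < 0 and x_{j+1} = t + j·s,
-- and call a pair {i, j} *labelled* when |x_i - x_j| ∈ P.  Since M₆ is the
-- complement of C = P₃ ⊔ P₃, a signature bijection π sends every unlabelled
-- pair to an edge of C and every labelled pair to a non-edge of C.  The graph
-- C has no path on four vertices, no triangle, no vertex of degree three and
-- no isolated vertex; the arithmetic of P leaves no room for that: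
--   * {x₀, x₅} is unlabelled, as |p - x₅| exceeds every element of P;
--   * if {x₀, x₄} is labelled then |p| = s, hence {x₀, x₃} is labelled;
--   * the labels of pairs inside the progression only depend on the step.
-- Hence either s ∉ P (then π x₀, π x₅, π x₄, π x₃ is a path of C), or 2s ∉ P
-- (path π x₁, π x₃, π x₅, π x₀), or {x₀, x₃} is unlabelled (π x₀ has degree 3
-- in C), or else x₃ is labelled with everything (π x₃ is isolated in C).

open import Defs
open import Data.Integer using (ℤ; +_; _<_; _≤_)
open import Relation.Nullary using (¬_)

open import Data.Nat as ℕ using (ℕ; suc; z<s)
import Data.Nat.Properties as ℕP
open import Data.Integer as ℤ using (-[1+_]; +<+; ∣_∣; _-_)
open import Data.Integer.Properties using (∣i-j∣≡∣j-i∣; +◃n≡+n; +-injective)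
open import Data.Integer.Tactic.RingSolver using (solve-∀)
open import Data.Fin using (Fin; zero; suc; toℕ; #_)
open import Data.Fin.Properties using (all?; any?; toℕ≤pred[n]) renaming (_≟_ to _≟ᶠ_)
open import Data.Product using (_×_; _,_; ∃; proj₁; proj₂)
open import Data.Product.Properties using (≡-dec)
open import Data.Sum using (inj₁; inj₂)
open import Data.Empty using (⊥; ⊥-elim)
open import Data.List.Membership.DecPropositional (≡-dec ℕP._≟_ ℕP._≟_) using (_∈?_)
open import Relation.Nullary using (Dec; yes; no)
open import Relation.Nullary.Decidable using (map′; _⊎-dec_; _×-dec_; ¬?; toWitness)
open import Relation.Binary.PropositionalEquality
open import Function.Bundles using (_⇔_; Bijection; Equivalence; mk⇔)

-- A pair of indices is labelled by S when the distance of their elements is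
-- itself an element of S; a signature matches labelled pairs with edges.
-- (A record rather than the bare Σ-type, so that the indices are inferable.)
record Labelled {n : ℕ} (S : Fin n → ℤ) (i j : Fin n) : Set where
  constructor labelledBy
  field
    label      : Fin n
    isDistance : S label ≡ + ∣ S i - S j ∣

labelled? : {n : ℕ} (S : Fin n → ℤ) → ∀ i j → Dec (Labelled S i j)
labelled? S i j = map′ (λ (k , eq) → labelledBy k eq) (λ (labelledBy k eq) → k , eq)
                       (any? λ k → S k ℤ.≟ + ∣ S i - S j ∣)

labelled-transfer : {n : ℕ} (S : Fin n → ℤ) {i j i′ j′ : Fin n} →
                    S i - S j ≡ S i′ - S j′ → Labelled S i j → Labelled S i′ j′
labelled-transfer S eq (labelledBy k Sk≡) = labelledBy k (trans Sk≡ (cong (λ d → + ∣ d ∣) eq))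

labelled-sym : {n : ℕ} (S : Fin n → ℤ) {i j : Fin n} → Labelled S i j → Labelled S j i
labelled-sym S {i} {j} (labelledBy k Sk≡) = labelledBy k (trans Sk≡ (cong +_ (∣i-j∣≡∣j-i∣ (S i) (S j))))

module ComplementSignature {n : ℕ} {C : Fin n → Fin n → Set}
  (C? : ∀ u v → Dec (C u v)) {S : Fin n → ℤ}
  (signature : HasSignature (λ u v → u ≢ v × ¬ C u v) S) where

  vertex : Fin n → Fin n
  vertex = Bijection.to (proj₁ signature)

  vertex-injective : ∀ {i j} → i ≢ j → vertex i ≢ vertex j
  vertex-injective i≢j eq = i≢j (Bijection.injective (proj₁ signature) eq)

  unlabelled⇒edge : ∀ {i j} → i ≢ j → ¬ Labelled S i j → C (vertex i) (vertex j)
  unlabelled⇒edge {i} {j} i≢j unlabelled with C? (vertex i) (vertex j)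
  ... | yes edge = edge
  ... | no ¬edge with Equivalence.to (proj₂ signature i j i≢j) (vertex-injective i≢j , ¬edge)
  ...   | k , eq = ⊥-elim (unlabelled (labelledBy k eq))

  labelled⇒nonEdge : ∀ {i j} → i ≢ j → Labelled S i j → ¬ C (vertex i) (vertex j)
  labelled⇒nonEdge {i} {j} i≢j (labelledBy k eq) =
    proj₂ (Equivalence.from (proj₂ signature i j i≢j) (k , eq))

  -- An index labelled with all others is sent to an isolated vertex of an
  -- irreflexive C, because every vertex is the image of some index.
  labelledWithAll⇒isolated : (∀ u → ¬ C u u) → ∀ {i} →
    (∀ j → i ≢ j → Labelled S i j) → ∀ w → ¬ C (vertex i) w
  labelledWithAll⇒isolated irreflexive {i} labelledWith w edge
    with Bijection.surjective (proj₁ signature) w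
  ... | j , hits with i ≟ᶠ j
  ...   | yes refl = irreflexive (vertex i) (subst (C (vertex i)) (sym (hits refl)) edge)
  ...   | no i≢j = labelled⇒nonEdge i≢j (labelledWith j i≢j)
                     (subst (C (vertex i)) (sym (hits refl)) edge)

complementAdj? : ∀ u v → Dec (ComplementAdj u v)
complementAdj? u v = (_ ∈? complementEdges) ⊎-dec (_ ∈? complementEdges)

complement-irreflexive : ∀ u → ¬ ComplementAdj u u
complement-irreflexive =
  toWitness {a? = all? λ u → ¬? (complementAdj? u u)} _

complement-noIsolated : ∀ u → ∃ λ w → ComplementAdj u w
complement-noIsolated =
  toWitness {a? = all? λ u → any? λ w → complementAdj? u w} _

-- No walk a-b-c-d with a ≠ c and b ≠ d: this excludes paths on four
-- vertices as well as triangles.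
complement-noPath3 : ∀ a b c d → ¬ (ComplementAdj a b × ComplementAdj b c ×
                                    ComplementAdj c d × a ≢ c × b ≢ d)
complement-noPath3 = toWitness {a? = all? λ a → all? λ b → all? λ c → all? λ d →
  ¬? (complementAdj? a b ×-dec complementAdj? b c ×-dec complementAdj? c d ×-dec
      ¬? (a ≟ᶠ c) ×-dec ¬? (b ≟ᶠ d))} _

complement-maxDegree2 : ∀ u a b c → ¬ (ComplementAdj u a × ComplementAdj u b ×
                          ComplementAdj u c × a ≢ b × b ≢ c × a ≢ c)
complement-maxDegree2 = toWitness {a? = all? λ u → all? λ a → all? λ b → all? λ c →
  ¬? (complementAdj? u a ×-dec complementAdj? u b ×-dec complementAdj? u c ×-dec
      ¬? (a ≟ᶠ b) ×-dec ¬? (b ≟ᶠ c) ×-dec ¬? (a ≟ᶠ c))} _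

progression-difference : ∀ p t s (i j : Fin 5) →
  Pset p t s (suc i) - Pset p t s (suc j) ≡ (+ toℕ i - + toℕ j) ℤ.* s
progression-difference p t s i j = lemma t s (+ toℕ i) (+ toℕ j)
  where
  lemma : ∀ t s x y → (t ℤ.+ x ℤ.* s) - (t ℤ.+ y ℤ.* s) ≡ (x - y) ℤ.* s
  lemma = solve-∀

progression-labelled : ∀ p t s {i j i′ j′ : Fin 5} → + toℕ i - + toℕ j ≡ + toℕ i′ - + toℕ j′ →
  Labelled (Pset p t s) (suc i) (suc j) → Labelled (Pset p t s) (suc i′) (suc j′)
progression-labelled p t s {i} {j} {i′} {j′} eq = labelled-transfer (Pset p t s) (begin
  Pset p t s (suc i) - Pset p t s (suc j)    ≡⟨ progression-difference p t s i j ⟩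
  (+ toℕ i - + toℕ j) ℤ.* s                  ≡⟨ cong (ℤ._* s) eq ⟩
  (+ toℕ i′ - + toℕ j′) ℤ.* s                ≡⟨ progression-difference p t s i′ j′ ⟨
  Pset p t s (suc i′) - Pset p t s (suc j′)  ∎)
  where open ≡-Reasoning

module NegativeElement (n a m : ℕ) where

  S : Fin 6 → ℤ
  S = Pset -[1+ n ] (+ a) (+ m)

  term : ∀ k → S (suc k) ≡ + (a ℕ.+ toℕ k ℕ.* m)
  term k = cong (ℤ._+_ (+ a)) (+◃n≡+n (toℕ k ℕ.* m))

  distanceToNegative : ∀ j → ∣ S zero - S (suc j) ∣ ≡ a ℕ.+ (toℕ j ℕ.* m ℕ.+ suc n)
  distanceToNegative j = begin
    ∣ -[1+ n ] - S (suc j) ∣                ≡⟨ cong (λ x → ∣ -[1+ n ] - x ∣) (term j) ⟩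
    ∣ -[1+ n ] - + (a ℕ.+ toℕ j ℕ.* m) ∣    ≡⟨ ∣i-j∣≡∣j-i∣ -[1+ n ] (+ (a ℕ.+ toℕ j ℕ.* m)) ⟩
    a ℕ.+ toℕ j ℕ.* m ℕ.+ suc n             ≡⟨ ℕP.+-assoc a _ _ ⟩
    a ℕ.+ (toℕ j ℕ.* m ℕ.+ suc n)           ∎
    where open ≡-Reasoning

  labelEquation : ∀ k j → (S (suc k) ≡ + ∣ S zero - S (suc j) ∣) ⇔
                          (toℕ k ℕ.* m ≡ toℕ j ℕ.* m ℕ.+ suc n)
  labelEquation k j = mk⇔
    (λ eq → ℕP.+-cancelˡ-≡ a _ _ (+-injective (begin
      + (a ℕ.+ toℕ k ℕ.* m)      ≡⟨ term k ⟨
      S (suc k)                   ≡⟨ eq ⟩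
      + ∣ S zero - S (suc j) ∣    ≡⟨ cong +_ (distanceToNegative j) ⟩
      + (a ℕ.+ (toℕ j ℕ.* m ℕ.+ suc n)) ∎)))
    (λ eq → begin
      S (suc k)                          ≡⟨ term k ⟩
      + (a ℕ.+ toℕ k ℕ.* m)              ≡⟨ cong (λ x → + (a ℕ.+ x)) eq ⟩
      + (a ℕ.+ (toℕ j ℕ.* m ℕ.+ suc n))  ≡⟨ cong +_ (distanceToNegative j) ⟨
      + ∣ S zero - S (suc j) ∣           ∎)
    where open ≡-Reasoning

  negativeLabel : ∀ j → Labelled S zero (suc j) →
                  ∃ λ (k : Fin 5) → toℕ k ℕ.* m ≡ toℕ j ℕ.* m ℕ.+ suc n
  negativeLabel j (labelledBy zero ())
  negativeLabel j (labelledBy (suc k) eq) = k , Equivalence.to (labelEquation k j) eq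

  tooSmall : ∀ {k j} → k ℕ.≤ j → k ℕ.* m ≢ j ℕ.* m ℕ.+ suc n
  tooSmall {k} {j} k≤j =
    ℕP.<⇒≢ (ℕP.≤-<-trans (ℕP.*-monoˡ-≤ m k≤j) (ℕP.m<m+n (j ℕ.* m) z<s))

  -- |p - x₅| lies beyond every element of P.
  farthestUnlabelled : ¬ Labelled S zero (# 5)
  farthestUnlabelled l with negativeLabel (# 4) l
  ... | k , eq = tooSmall (toℕ≤pred[n] k) eq

  -- If |p - x₄| ∈ P it must be x₅, so |p| = s and |p - x₃| = x₄ ∈ P.
  secondFarthest⇒third : Labelled S zero (# 4) → Labelled S zero (# 3)
  secondFarthest⇒third l with negativeLabel (# 3) l
  ... | k , eq with ℕP.m≤n⇒m<n∨m≡n (toℕ≤pred[n] k)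
  ...   | inj₁ k<4 = ⊥-elim (tooSmall (ℕP.<⇒≤pred k<4) eq)
  ...   | inj₂ k≡4 = labelledBy (# 4) (Equivalence.from (labelEquation (# 3) (# 2)) (stepDown
          (trans (cong (ℕ._* m) (sym k≡4)) eq)))
    where
    stepDown : 4 ℕ.* m ≡ 3 ℕ.* m ℕ.+ suc n → 3 ℕ.* m ≡ 2 ℕ.* m ℕ.+ suc n
    stepDown eq4 = ℕP.+-cancelˡ-≡ m _ _ (trans eq4 (ℕP.+-assoc m (2 ℕ.* m) (suc n)))

module NoSignature (n a m : ℕ)
  (signature : HasSignature M6Adj (Pset -[1+ n ] (+ a) (+ m))) where

  open NegativeElement n a m
  open ComplementSignature complementAdj? signature

  sameStep : ∀ {i j i′ j′ : Fin 5} → + toℕ i - + toℕ j ≡ + toℕ i′ - + toℕ j′ →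
             Labelled S (suc i) (suc j) → Labelled S (suc i′) (suc j′)
  sameStep = progression-labelled -[1+ n ] (+ a) (+ m)

  -- s ∉ P: then π x₀, π x₅, π x₄, π x₃ is a path of C.
  stepUnlabelled : ¬ Labelled S (# 4) (# 3) → ⊥
  stepUnlabelled ¬step = complement-noPath3 (vertex (# 0)) (vertex (# 5)) (vertex (# 4)) (vertex (# 3))
    ( unlabelled⇒edge (λ ()) farthestUnlabelled
    , unlabelled⇒edge (λ ()) (λ l → ¬step (sameStep refl l))
    , unlabelled⇒edge (λ ()) ¬step
    , vertex-injective (λ ()) , vertex-injective (λ ()))

  -- 2s ∉ P: then π x₁, π x₃, π x₅, π x₀ is a path of C.
  doubleStepUnlabelled : ¬ Labelled S (# 3) (# 5) → ⊥
  doubleStepUnlabelled ¬double = complement-noPath3 (vertex (# 1)) (vertex (# 3)) (vertex (# 5)) (vertex (# 0))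
    ( unlabelled⇒edge (λ ()) (λ l → ¬double (sameStep refl l))
    , unlabelled⇒edge (λ ()) ¬double
    , unlabelled⇒edge (λ ()) (λ l → farthestUnlabelled (labelled-sym S l))
    , vertex-injective (λ ()) , vertex-injective (λ ()))

  -- |p - x₃| ∉ P: then π x₀ is joined in C to π x₃, π x₄ and π x₅.
  thirdUnlabelled : ¬ Labelled S (# 0) (# 3) → ⊥
  thirdUnlabelled ¬third = complement-maxDegree2 (vertex (# 0)) (vertex (# 3)) (vertex (# 4)) (vertex (# 5))
    ( unlabelled⇒edge (λ ()) ¬third
    , unlabelled⇒edge (λ ()) (λ l → ¬third (secondFarthest⇒third l))
    , unlabelled⇒edge (λ ()) farthestUnlabelled
    , vertex-injective (λ ()) , vertex-injective (λ ()) , vertex-injective (λ ()))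

  -- Otherwise x₃ is labelled with every other element, so π x₃ is isolated in C.
  allLabelled : Labelled S (# 4) (# 3) → Labelled S (# 3) (# 5) → Labelled S (# 0) (# 3) → ⊥
  allLabelled step double third =
    labelledWithAll⇒isolated complement-irreflexive labelledWithAll w edge
    where
    w : Fin 6
    w = proj₁ (complement-noIsolated (vertex (# 3)))

    edge : ComplementAdj (vertex (# 3)) w
    edge = proj₂ (complement-noIsolated (vertex (# 3)))

    labelledWithAll : ∀ j → # 3 ≢ j → Labelled S (# 3) j
    labelledWithAll zero _ = labelled-sym S third
    labelledWithAll (suc zero) _ = sameStep refl (labelled-sym S double)
    labelledWithAll (suc (suc zero)) _ = sameStep refl step
    labelledWithAll (suc (suc (suc zero))) 3≢3 = ⊥-elim (3≢3 refl)
    labelledWithAll (suc (suc (suc (suc zero)))) _ = labelled-sym S step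
    labelledWithAll (suc (suc (suc (suc (suc zero))))) _ = double

  impossible : ⊥
  impossible with labelled? S (# 4) (# 3) | labelled? S (# 3) (# 5) | labelled? S (# 0) (# 3)
  ... | no ¬step  | _          | _          = stepUnlabelled ¬step
  ... | yes _     | no ¬double | _          = doubleStepUnlabelled ¬double
  ... | yes _     | yes _      | no ¬third  = thirdUnlabelled ¬third
  ... | yes step  | yes double | yes third  = allLabelled step double third

-- The sign hypotheses put P in the coordinates of NoSignature (the argument
-- only needs s ≥ 0); the remaining sign patterns contradict them.
lemma6 : (p t s : ℤ) → p < + 0 → + 0 ≤ t → + 0 < s → ¬ HasSignature M6Adj (Pset p t s)
lemma6 -[1+ n ] (+ a) (+ m) _ _ _ signature = NoSignature.impossible n a m signature
lemma6 (+ _) _ _ (+<+ ()) _ _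
lemma6 -[1+ _ ] -[1+ _ ] _ _ () _
lemma6 -[1+ _ ] (+ _) -[1+ _ ] _ _ ()
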